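{- Let $F$ be a formula and let $M$ and $M'$ be x-models of $F$. Let $X$ be the set of variables of $F$ that are assigned different values by $M$ and $M'$. Then every clause of $F$ contains either zero or exactly two literals derived from variables in $X$.
   Context: A literal is a propositional variable $p$ or its negation $\bar p$; both are said to be derived from the variable $p$. A clause is a disjunction of literals, and a formula is a finite set of clauses. An x-model of a formula $F$ is an assignment of truth values to the variables of $F$ under which every clause of $F$ contains exactly one true literal. -}

module Defs where

open import Data.Nat using (ℕ)
open import Data.Bool using (Bool; true; false; not)
open import Data.List using (List; length; filter)
open import Data.List.Relation.Unary.All using (All)
open import Data.List.Relation.Unary.Unique.Propositional using (Unique)
open import Relation.Binary.PropositionalEquality using (_≡_; _≢_)
open import Relation.Nullary using (Dec; ¬_)
open import Relation.Nullary.Decidable using (¬?)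
open import Data.Bool.Properties using () renaming (_≟_ to _≟B_)

Var : Set
Var = ℕ

-- A literal: the variable it is derived from, and a polarity
-- (true = p, false = p̄).
record Literal : Set where
  constructor lit
  field
    var : Var
    pos : Bool
open Literal public

Clause : Set
Clause = List Literal

Formula : Set
Formula = List Clause

WellFormedClause : Clause → Set
WellFormedClause C = Unique C

-- Truth assignment (only values on variables of F matter).
Assignment : Set
Assignment = Var → Bool

litVal : Assignment → Literal → Bool
litVal M (lit p true)  = M p
litVal M (lit p false) = not (M p)

numTrue : Assignment → Clause → ℕ
numTrue M C = length (filter (λ l → litVal M l ≟B true) C)

IsXModel : Assignment → Formula → Set
IsXModel M F = All (λ C → numTrue M C ≡ 1) F

-- Number of literals of C derived from a variable on which M and M' differ
-- (i.e. from a variable in X).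
numInX : Assignment → Assignment → Clause → ℕ
numInX M M' C = length (filter (λ l → ¬? (M (var l) ≟B M' (var l))) C)

-- A literal derived from a variable in X is true under exactly one of M and M',
-- while any other literal is true under both or under neither. Counting the
-- true literals of a clause C under M and under M' therefore gives
--   numTrue M C + numTrue M' C = 2 · (literals true under both) + numInX M M' C,
-- and in an x-model of both the left-hand side is 1 + 1 = 2, so numInX M M' C is 0 or 2.
module Submission where

open import Defs
open import Data.Bool using (true; false; _∧_)
open import Data.Bool.Properties using () renaming (_≟_ to _≟B_)
open import Data.Empty using (⊥-elim)
open import Data.List using ([]; _∷_; length; filter)
open import Data.List.Relation.Unary.All using (All; []; _∷_)
open import Data.Nat using (ℕ; suc; _+_; _*_)
open import Data.Nat.Properties using (+-suc; suc-injective; m+n≡0⇒m≡0; m+n≡0⇒n≡0)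
open import Data.Nat.Tactic.RingSolver using (solve-∀)
open import Data.Sum using (_⊎_; inj₁; inj₂)
open import Relation.Binary.PropositionalEquality using (_≡_; refl; cong; cong₂; sym; trans)
open Relation.Binary.PropositionalEquality.≡-Reasoning

numTrueBoth : Assignment → Assignment → Clause → ℕ
numTrueBoth M M' C = length (filter (λ l → (litVal M l ∧ litVal M' l) ≟B true) C)

twice-suc : ∀ c x → 2 * suc c + x ≡ suc (suc (2 * c + x))
twice-suc = solve-∀

step-trueBoth : ∀ t t' c {x} → t + t' ≡ 2 * c + x → suc t + suc t' ≡ 2 * suc c + x
step-trueBoth t t' c {x} eq = begin
  suc t + suc t'          ≡⟨ cong suc (+-suc t t') ⟩
  suc (suc (t + t'))      ≡⟨ cong (λ n → suc (suc n)) eq ⟩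
  suc (suc (2 * c + x))   ≡⟨ sym (twice-suc c x) ⟩
  2 * suc c + x           ∎

step-trueLeft : ∀ t t' c {x} → t + t' ≡ 2 * c + x → suc t + t' ≡ 2 * c + suc x
step-trueLeft t t' c {x} eq = trans (cong suc eq) (sym (+-suc (2 * c) x))

step-trueRight : ∀ t t' c {x} → t + t' ≡ 2 * c + x → t + suc t' ≡ 2 * c + suc x
step-trueRight t t' c eq = trans (+-suc t t') (step-trueLeft t t' c eq)

numTrue-+-numTrue : ∀ M M' C →
  numTrue M C + numTrue M' C ≡ 2 * numTrueBoth M M' C + numInX M M' C
numTrue-+-numTrue M M' [] = refl
numTrue-+-numTrue M M' (lit p true ∷ C) with M p | M' p | numTrue-+-numTrue M M' C
... | true  | true  | ih = step-trueBoth (numTrue M C) (numTrue M' C) (numTrueBoth M M' C) ih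
... | true  | false | ih = step-trueLeft (numTrue M C) (numTrue M' C) (numTrueBoth M M' C) ih
... | false | true  | ih = step-trueRight (numTrue M C) (numTrue M' C) (numTrueBoth M M' C) ih
... | false | false | ih = ih
numTrue-+-numTrue M M' (lit p false ∷ C) with M p | M' p | numTrue-+-numTrue M M' C
... | true  | true  | ih = ih
... | true  | false | ih = step-trueRight (numTrue M C) (numTrue M' C) (numTrueBoth M M' C) ih
... | false | true  | ih = step-trueLeft (numTrue M C) (numTrue M' C) (numTrueBoth M M' C) ih
... | false | false | ih = step-trueBoth (numTrue M C) (numTrue M' C) (numTrueBoth M M' C) ih

even+≡2 : ∀ c x → 2 * c + x ≡ 2 → x ≡ 0 ⊎ x ≡ 2
even+≡2 0 x eq = inj₂ eq
even+≡2 1 x eq = inj₁ (suc-injective (suc-injective eq))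
-- For c ≥ 2 the left-hand side is at least 4.
even+≡2 (suc (suc c)) x eq
  with m+n≡0⇒n≡0 c (m+n≡0⇒m≡0 _ (suc-injective (suc-injective eq)))
... | ()

mainTheorem1 : (F : Formula) → All WellFormedClause F →
    (M M' : Assignment) → IsXModel M F → IsXModel M' F →
    All (λ C → (numInX M M' C ≡ 0) ⊎ (numInX M M' C ≡ 2)) F
mainTheorem1 [] [] M M' [] [] = []
-- The argument never uses that the literals of a clause are distinct.
mainTheorem1 (C ∷ F) (_ ∷ wf) M M' (one ∷ xm) (one' ∷ xm') =
  even+≡2 (numTrueBoth M M' C) (numInX M M' C) twoTrue ∷ mainTheorem1 F wf M M' xm xm'
  where
  twoTrue : 2 * numTrueBoth M M' C + numInX M M' C ≡ 2
  twoTrue = begin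
    2 * numTrueBoth M M' C + numInX M M' C   ≡⟨ sym (numTrue-+-numTrue M M' C) ⟩
    numTrue M C + numTrue M' C               ≡⟨ cong₂ _+_ one one' ⟩
    1 + 1                                    ∎
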